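{- Let $0<1/n\ll \eta \ll 1$. Suppose $G$ is an $n$-vertex graph with $\widetilde{\alpha}(G)\leq \eta n$. If $W$ and $W'$ are two (not necessarily disjoint) subsets of $V(G)$ each of size at least $2\eta^{1/3} n$, then all but at most $2\eta n$ vertices $w\in W$ satisfy $d_{G,W'}(w)\geq \eta^{ -1/2}$.
   Context: The notation $0<a\ll b\ll 1$ means: there exist non-decreasing functions $f,g:(0,1]\to(0,1]$ such that the statement holds whenever $a\le f(b)$ (and similarly $1/n\le g(\eta)$ for the first relation). $d_{G,W'}(w)$ is the number of neighbours of $w$ in $G$ lying in $W'$. An $(s,t)$-bipartite hole in $G$ is a pair of disjoint sets $S,T\subseteq V(G)$ with $|S|=s$, $|T|=t$ and no edges of $G$ between them; the bi-independence number $\widetilde{\alpha}(G)$ is the largest $r$ such that $G$ contains an $(s,t)$-bipartite hole for every pair of non-negative integers $s,t$ with $s+t=r$.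
   Formalization: The parameter η ranges over the rationals in (0,1], and the threshold and non-decreasing functions behind $0<1/n\ll \eta \ll 1$ are likewise taken over the rationals. -}

module Defs where

open import Data.Nat using (ℕ; _+_)
open import Data.Bool using (Bool; true; false)
open import Data.Fin using (Fin)
open import Data.Fin.Subset using (Subset; _∈_; _∩_; ∣_∣; Empty)
open import Data.Vec using (tabulate)
open import Data.Integer using (+_)
open import Data.Rational using (ℚ; _/_; _≤_; _<_; _*_; 0ℚ; 1ℚ)
open import Data.Product using (Σ; _×_; ∃)
open import Relation.Binary.PropositionalEquality using (_≡_)

record Graph (n : ℕ) : Set where
  field
    Adj   : Fin n → Fin n → Bool
    sym   : ∀ u v → Adj u v ≡ Adj v u
    irref : ∀ v → Adj v v ≡ false
open Graph public

ℕtoℚ : ℕ → ℚ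
ℕtoℚ k = (+ k) / 1

N : ∀ {n} → Graph n → Fin n → Subset n
N G w = tabulate (Adj G w)

deg-in : ∀ {n} → Graph n → Subset n → Fin n → ℕ
deg-in G W' w = ∣ N G w ∩ W' ∣

BipartiteHole : ∀ {n} → Graph n → ℕ → ℕ → Set
BipartiteHole {n} G s t =
  Σ (Subset n) λ S → Σ (Subset n) λ T →
    Empty (S ∩ T) × ∣ S ∣ ≡ s × ∣ T ∣ ≡ t ×
    (∀ u v → u ∈ S → v ∈ T → Adj G u v ≡ false)

AllHoles : ∀ {n} → Graph n → ℕ → Set
AllHoles G r = ∀ s t → s + t ≡ r → BipartiteHole G s t

-- α̃(G) ≤ x : α̃(G) is the largest r with AllHoles G r, so α̃(G) ≤ x
-- iff every r with AllHoles G r satisfies r ≤ x.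
biIndep≤ : ∀ {n} → Graph n → ℚ → Set
biIndep≤ G x = ∀ r → AllHoles G r → ℕtoℚ r ≤ x

InUnit : ℚ → Set
InUnit x = (0ℚ < x) × (x ≤ 1ℚ)

IsScale : (ℚ → ℚ) → Set
IsScale f = (∀ x → InUnit x → InUnit (f x)) ×
            (∀ x y → InUnit x → InUnit y → x ≤ y → f x ≤ f y)

-- We take η₀ = 1/1024 and the scale function f = id (so only ηn ≥ 1 is used).
-- Suppose B is a set of bad vertices, each with η·d_{W'}(w)² < 1, and
-- |B| > 2ηn.  Pick an integer k with ηn < k ≤ ηn + 1 ≤ 2ηn and a set S ⊆ B of
-- k bad vertices.  For every u ∈ S the cube bound |W'|³ ≥ 8ηn³ together with
-- η²(2 + d(u))³ ≤ 1 gives k·(2 + d(u)) ≤ |W'|; averaging over S yields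
-- 2k + Σ_{u∈S} d(u) ≤ |W'|.  Hence T = W' ∖ (S ∪ ⋃_{u∈S} N(u)) has at least k
-- elements, and (S, T) is a (k,k)-bipartite hole, so G has an (s,t)-hole for
-- all s + t = k.  Then α̃(G) ≥ k > ηn, a contradiction.

module Submission where

open import Defs
open import Data.Nat using (ℕ; NonZero)
open import Data.Fin using (Fin)
open import Data.Fin.Subset using (Subset; _∈_; _⊆_; ∣_∣)
open import Data.Integer using (+_)
open import Data.Rational using (ℚ; _/_; _≤_; _<_; _*_; 1ℚ)
open import Data.Product using (Σ; _×_)
open import Relation.Nullary using (¬_)

open import Data.Nat as ℕ using (zero; suc; z≤n; s≤s)
import Data.Nat.Properties as ℕP
import Data.Nat.Solver
open import Data.Nat.Coprimality using (1-coprimeTo) renaming (sym to coprime-sym)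
import Data.Integer as ℤ
import Data.Integer.Properties as ℤP
open import Data.Rational using (mkℚ; _+_; 0ℚ; 1/_; *≤*; nonNegative; positive)
import Data.Rational.Properties as ℚP
open ℚP using (≤-trans; ≤-refl; <-≤-trans; ≤-<-trans; <⇒≤; ≰⇒>; ≮⇒≥; <-irrefl; _≤?_; _<?_)
import Data.Rational.Solver
open import Data.Bool using (true; false)
open import Data.Fin using (zero; suc)
open import Data.Fin.Subset using (_∉_; _∪_; _∩_; _─_; ⊥; Empty)
open import Data.Fin.Subset.Properties using (∉⊥; ∣⊥∣≡0; p⊆p∪q; q⊆p∪q; x∈p∩q⁻; x∈p∩q⁺)
open import Data.Vec using ([]; _∷_; here; there)
open import Data.Vec.Properties using (lookup⇒[]=; lookup∘tabulate)
open import Data.Empty using (⊥-elim) renaming (⊥ to False)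
open import Data.Product using (_,_; proj₁; proj₂)
open import Data.Sum using (inj₁; inj₂)
open import Data.Unit using (tt)
open import Relation.Nullary using (yes; no)
open import Relation.Nullary.Decidable using (toWitness; decidable-stable)
open import Relation.Binary.PropositionalEquality using (_≡_; refl; trans; cong; subst; subst₂) renaming (sym to ≡-sym)
open import Function using (_∘_)

module ℕS = Data.Nat.Solver.+-*-Solver
module ℚS = Data.Rational.Solver.+-*-Solver

ℕtoℚ-normal : ∀ k → ℕtoℚ k ≡ mkℚ (+ k) 0 (coprime-sym (1-coprimeTo k))
ℕtoℚ-normal k = ℚP.normalize-coprime {k} {0} (coprime-sym (1-coprimeTo k))

ℕtoℚ-+ : ∀ a b → ℕtoℚ a + ℕtoℚ b ≡ ℕtoℚ (a ℕ.+ b)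
ℕtoℚ-+ a b rewrite ℕtoℚ-normal a | ℕtoℚ-normal b | ℕtoℚ-normal (a ℕ.+ b)
                 | ℤP.*-identityʳ (+ a) | ℤP.*-identityʳ (+ b) | ≡-sym (ℤP.pos-+ a b) =
  ℕtoℚ-normal (a ℕ.+ b)

ℕtoℚ-* : ∀ a b → ℕtoℚ a * ℕtoℚ b ≡ ℕtoℚ (a ℕ.* b)
ℕtoℚ-* a b rewrite ℕtoℚ-normal a | ℕtoℚ-normal b | ℕtoℚ-normal (a ℕ.* b)
                 | ≡-sym (ℤP.pos-* a b) =
  ℕtoℚ-normal (a ℕ.* b)

ℕtoℚ-cube : ∀ a → ℕtoℚ a * ℕtoℚ a * ℕtoℚ a ≡ ℕtoℚ (a ℕ.* a ℕ.* a)
ℕtoℚ-cube a = trans (cong (_* ℕtoℚ a) (ℕtoℚ-* a a)) (ℕtoℚ-* (a ℕ.* a) a)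

ℕtoℚ-mono-≤ : ∀ {a b} → a ℕ.≤ b → ℕtoℚ a ≤ ℕtoℚ b
ℕtoℚ-mono-≤ {a} {b} a≤b rewrite ℕtoℚ-normal a | ℕtoℚ-normal b =
  *≤* (subst₂ ℤ._≤_ (≡-sym (ℤP.*-identityʳ (+ a))) (≡-sym (ℤP.*-identityʳ (+ b))) (ℤ.+≤+ a≤b))

ℕtoℚ-cancel-≤ : ∀ {a b} → ℕtoℚ a ≤ ℕtoℚ b → a ℕ.≤ b
ℕtoℚ-cancel-≤ {a} {b} h rewrite ℕtoℚ-normal a | ℕtoℚ-normal b with h
... | *≤* h′ = ℤP.drop‿+≤+ (subst₂ ℤ._≤_ (ℤP.*-identityʳ (+ a)) (ℤP.*-identityʳ (+ b)) h′)

ℕtoℚ-nonNeg : ∀ a → 0ℚ ≤ ℕtoℚ a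
ℕtoℚ-nonNeg a = ℕtoℚ-mono-≤ {0} {a} z≤n

reciprocal-≤⇒1≤ : ∀ n .{{_ : NonZero n}} η → (+ 1) / n ≤ η → 1ℚ ≤ η * ℕtoℚ n
reciprocal-≤⇒1≤ (suc m) η 1/n≤η = begin
  1ℚ                  ≡⟨ ≡-sym (ℚP.*-inverseˡ n) ⟩
  1/ n * n            ≤⟨ ℚP.*-monoʳ-≤-nonNeg n {{nonNegative n≥0}} 1/n≤η′ ⟩
  η * n               ≡⟨ cong (η *_) (≡-sym (ℕtoℚ-normal (suc m))) ⟩
  η * ℕtoℚ (suc m)    ∎
  where
  open ℚP.≤-Reasoning
  n = mkℚ (+ suc m) 0 (coprime-sym (1-coprimeTo (suc m)))
  n≥0 : 0ℚ ≤ n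
  n≥0 = subst (0ℚ ≤_) (ℕtoℚ-normal (suc m)) (ℕtoℚ-nonNeg (suc m))
  1/n≤η′ : 1/ n ≤ η
  1/n≤η′ = subst (_≤ η) (ℚP.normalize-coprime {1} {m} (1-coprimeTo (suc m))) 1/n≤η

*-mono-≤ : ∀ {a b c d} → 0ℚ ≤ a → 0ℚ ≤ c → a ≤ b → c ≤ d → a * c ≤ b * d
*-mono-≤ {a} {b} {c} {d} 0≤a 0≤c a≤b c≤d =
  ≤-trans (ℚP.*-monoˡ-≤-nonNeg a {{nonNegative 0≤a}} c≤d)
          (ℚP.*-monoʳ-≤-nonNeg d {{nonNegative (≤-trans 0≤c c≤d)}} a≤b)

*-nonNeg : ∀ {a c} → 0ℚ ≤ a → 0ℚ ≤ c → 0ℚ ≤ a * c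
*-nonNeg 0≤a 0≤c = *-mono-≤ ≤-refl ≤-refl 0≤a 0≤c

cube-mono-≤ : ∀ {a b} → 0ℚ ≤ a → a ≤ b → a * a * a ≤ b * b * b
cube-mono-≤ 0≤a a≤b = *-mono-≤ (*-nonNeg 0≤a 0≤a) 0≤a (*-mono-≤ 0≤a 0≤a a≤b a≤b) a≤b

cube-cancel-≤ : ∀ x a → x ℕ.* x ℕ.* x ℕ.≤ a ℕ.* a ℕ.* a → x ℕ.≤ a
cube-cancel-≤ x a x³≤a³ with ℕP.≤-<-connex x a
... | inj₁ x≤a = x≤a
... | inj₂ a<x = ⊥-elim (ℕP.<⇒≱ (ℕP.*-mono-< (ℕP.*-mono-< a<x a<x) a<x) x³≤a³)

-- The numerical heart of the lemma: the threshold η₀ = 1/1024 makes a bad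
-- vertex's degree d (η d² < 1) satisfy η²(2 + d)³ ≤ 1.

1/32 : ℚ
1/32 = (+ 1) / 32

η₀ : ℚ
η₀ = 1/32 * 1/32

-- If η D² < 1 then (ηD)² < η ≤ η₀ = (1/32)², so ηD ≤ 1/32.
scaled-degree-≤ : ∀ η D → 0ℚ < η → η ≤ η₀ → η * (D * D) < 1ℚ → η * D ≤ 1/32
scaled-degree-≤ η D 0<η η≤η₀ ηD²<1 with η * D ≤? 1/32
... | yes ηD≤ = ηD≤
... | no ηD≰ = ⊥-elim (<-irrefl refl η₀<η₀)
  where
  open ℚP.≤-Reasoning
  1/32<ηD : 1/32 < η * D
  1/32<ηD = ≰⇒> ηD≰
  0<ηD : 0ℚ < η * D
  0<ηD = ≤-<-trans (toWitness {a? = 0ℚ ≤? 1/32} tt) 1/32<ηD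
  η₀<η₀ : η₀ < η₀
  η₀<η₀ = begin-strict
    η₀                  ≡⟨⟩
    1/32 * 1/32         ≤⟨ ℚP.*-monoˡ-≤-nonNeg 1/32 (<⇒≤ 1/32<ηD) ⟩
    1/32 * (η * D)      <⟨ ℚP.*-monoˡ-<-pos (η * D) {{positive 0<ηD}} 1/32<ηD ⟩
    η * D * (η * D)     ≡⟨ ℚS.solve 2 (λ e d → e ℚS.:* d ℚS.:* (e ℚS.:* d) ℚS.:= e ℚS.:* (e ℚS.:* (d ℚS.:* d))) refl η D ⟩
    η * (η * (D * D))   ≤⟨ ℚP.*-monoˡ-≤-nonNeg η {{nonNegative (<⇒≤ 0<η)}} (<⇒≤ ηD²<1) ⟩
    η * 1ℚ              ≡⟨ ℚP.*-identityʳ η ⟩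
    η                   ≤⟨ η≤η₀ ⟩
    η₀                  ∎

-- (2 + x)³ ≤ 27 x³ for x ≥ 1, since 2 + x ≤ 3x.
shifted-cube-≤ : ∀ x → 1 ℕ.≤ x → (2 ℕ.+ x) ℕ.* (2 ℕ.+ x) ℕ.* (2 ℕ.+ x) ℕ.≤ 27 ℕ.* (x ℕ.* x ℕ.* x)
shifted-cube-≤ x 1≤x = ℕP.≤-trans (ℕP.*-mono-≤ (ℕP.*-mono-≤ 2+x≤3x 2+x≤3x) 2+x≤3x) (ℕP.≤-reflexive 27x³)
  where
  2+x≤3x : 2 ℕ.+ x ℕ.≤ 3 ℕ.* x
  2+x≤3x = ℕP.≤-trans (ℕP.+-mono-≤ (ℕP.+-mono-≤ 1≤x 1≤x) ℕP.≤-refl)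
             (ℕP.≤-reflexive (ℕS.solve 1 (λ y → y ℕS.:+ y ℕS.:+ y ℕS.:= ℕS.con 3 ℕS.:* y) refl x))
  27x³ : 3 ℕ.* x ℕ.* (3 ℕ.* x) ℕ.* (3 ℕ.* x) ≡ 27 ℕ.* (x ℕ.* x ℕ.* x)
  27x³ = ℕS.solve 1 (λ y → ℕS.con 3 ℕS.:* y ℕS.:* (ℕS.con 3 ℕS.:* y) ℕS.:* (ℕS.con 3 ℕS.:* y)
                             ℕS.:= ℕS.con 27 ℕS.:* (y ℕS.:* y ℕS.:* y)) refl x

-- For d ≥ 1: (2+d)³ ≤ 27d³ and η²d³ = (ηd²)(ηd) ≤ 1/32 give η²(2+d)³ ≤ 27/32.
positive-degree-cube-≤ : ∀ η d → 1 ℕ.≤ d → 0ℚ < η → η ≤ η₀ → η * (ℕtoℚ d * ℕtoℚ d) < 1ℚ →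
                         η * η * (ℕtoℚ (2 ℕ.+ d) * ℕtoℚ (2 ℕ.+ d) * ℕtoℚ (2 ℕ.+ d)) ≤ 1ℚ
positive-degree-cube-≤ η d 1≤d 0<η η≤η₀ ηD²<1 = begin
  η * η * E³                              ≤⟨ ℚP.*-monoˡ-≤-nonNeg (η * η) {{nonNegative (*-nonNeg 0≤η 0≤η)}} E³≤27D³ ⟩
  η * η * (ℕtoℚ 27 * (D * D * D))         ≡⟨ ℚS.solve 3 (λ e x c → e ℚS.:* e ℚS.:* (c ℚS.:* (x ℚS.:* x ℚS.:* x))
                                                ℚS.:= c ℚS.:* (e ℚS.:* (x ℚS.:* x)) ℚS.:* (e ℚS.:* x)) refl η D (ℕtoℚ 27) ⟩
  ℕtoℚ 27 * (η * (D * D)) * (η * D)       ≤⟨ *-mono-≤ (*-nonNeg (ℕtoℚ-nonNeg 27) (*-nonNeg 0≤η (*-nonNeg 0≤D 0≤D)))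
                                                (*-nonNeg 0≤η 0≤D)
                                                (ℚP.*-monoˡ-≤-nonNeg (ℕtoℚ 27) (<⇒≤ ηD²<1))
                                                (scaled-degree-≤ η D 0<η η≤η₀ ηD²<1) ⟩
  ℕtoℚ 27 * 1ℚ * 1/32             ≤⟨ toWitness {a? = ℕtoℚ 27 * 1ℚ * 1/32 ≤? 1ℚ} tt ⟩
  1ℚ                                      ∎
  where
  open ℚP.≤-Reasoning
  D = ℕtoℚ d
  E³ = ℕtoℚ (2 ℕ.+ d) * ℕtoℚ (2 ℕ.+ d) * ℕtoℚ (2 ℕ.+ d)
  0≤η = <⇒≤ 0<η
  0≤D = ℕtoℚ-nonNeg d
  E³≤27D³ : E³ ≤ ℕtoℚ 27 * (D * D * D)
  E³≤27D³ = begin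
    E³                              ≡⟨ ℕtoℚ-cube (2 ℕ.+ d) ⟩
    ℕtoℚ ((2 ℕ.+ d) ℕ.* (2 ℕ.+ d) ℕ.* (2 ℕ.+ d))
                                    ≤⟨ ℕtoℚ-mono-≤ (shifted-cube-≤ d 1≤d) ⟩
    ℕtoℚ (27 ℕ.* (d ℕ.* d ℕ.* d))   ≡⟨ ≡-sym (ℕtoℚ-* 27 (d ℕ.* d ℕ.* d)) ⟩
    ℕtoℚ 27 * ℕtoℚ (d ℕ.* d ℕ.* d)  ≡⟨ cong (ℕtoℚ 27 *_) (≡-sym (ℕtoℚ-cube d)) ⟩
    ℕtoℚ 27 * (D * D * D)           ∎

bad-degree-cube-≤ : ∀ η d → 0ℚ < η → η ≤ η₀ → η * (ℕtoℚ d * ℕtoℚ d) < 1ℚ →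
                    η * η * (ℕtoℚ (2 ℕ.+ d) * ℕtoℚ (2 ℕ.+ d) * ℕtoℚ (2 ℕ.+ d)) ≤ 1ℚ
bad-degree-cube-≤ η zero 0<η η≤η₀ _ = begin
  η * η * E³        ≤⟨ ℚP.*-monoʳ-≤-nonNeg E³ {{nonNegative (toWitness {a? = 0ℚ ≤? E³} tt)}}
                         (*-mono-≤ (<⇒≤ 0<η) (<⇒≤ 0<η) η≤η₀ η≤η₀) ⟩
  η₀ * η₀ * E³      ≤⟨ toWitness {a? = η₀ * η₀ * E³ ≤? 1ℚ} tt ⟩
  1ℚ                ∎
  where
  open ℚP.≤-Reasoning
  E³ = ℕtoℚ 2 * ℕtoℚ 2 * ℕtoℚ 2
bad-degree-cube-≤ η (suc d) = positive-degree-cube-≤ η (suc d) (s≤s z≤n)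

-- Degree budget: if k ≤ 2ηn, |W'|³ ≥ 8ηn³ and η d² < 1, then k(2 + d) ≤ |W'|,
-- because (k(2+d))³ ≤ 8ηn³ · η²(2+d)³ ≤ 8ηn³ ≤ |W'|³.
degree-budget : ∀ η n k d a → 0ℚ < η → η ≤ η₀ →
                ℕtoℚ k ≤ ℕtoℚ 2 * η * ℕtoℚ n →
                η * (ℕtoℚ d * ℕtoℚ d) < 1ℚ →
                ℕtoℚ 8 * η * (ℕtoℚ n * ℕtoℚ n * ℕtoℚ n) ≤ ℕtoℚ a * ℕtoℚ a * ℕtoℚ a →
                k ℕ.* (2 ℕ.+ d) ℕ.≤ a
degree-budget η n k d a 0<η η≤η₀ k≤2ηn ηd²<1 8ηn³≤a³ = cube-cancel-≤ x a (ℕtoℚ-cancel-≤ x³≤a³)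
  where
  open ℚP.≤-Reasoning
  x = k ℕ.* (2 ℕ.+ d)
  K = ℕtoℚ k
  E = ℕtoℚ (2 ℕ.+ d)
  Nq = ℕtoℚ n
  8ηn³ = ℕtoℚ 8 * η * (Nq * Nq * Nq)
  0≤E³ : 0ℚ ≤ E * E * E
  0≤E³ = *-nonNeg (*-nonNeg (ℕtoℚ-nonNeg (2 ℕ.+ d)) (ℕtoℚ-nonNeg (2 ℕ.+ d))) (ℕtoℚ-nonNeg (2 ℕ.+ d))
  0≤8ηn³ : 0ℚ ≤ 8ηn³
  0≤8ηn³ = *-nonNeg (*-nonNeg (ℕtoℚ-nonNeg 8) (<⇒≤ 0<η))
                    (*-nonNeg (*-nonNeg (ℕtoℚ-nonNeg n) (ℕtoℚ-nonNeg n)) (ℕtoℚ-nonNeg n))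
  x³≤a³ : ℕtoℚ (x ℕ.* x ℕ.* x) ≤ ℕtoℚ (a ℕ.* a ℕ.* a)
  x³≤a³ = begin
    ℕtoℚ (x ℕ.* x ℕ.* x)                  ≡⟨ ≡-sym (ℕtoℚ-cube x) ⟩
    ℕtoℚ x * ℕtoℚ x * ℕtoℚ x              ≡⟨ cong (λ z → z * z * z) (≡-sym (ℕtoℚ-* k (2 ℕ.+ d))) ⟩
    K * E * (K * E) * (K * E)             ≡⟨ ℚS.solve 2 (λ p q → p ℚS.:* q ℚS.:* (p ℚS.:* q) ℚS.:* (p ℚS.:* q)
                                                ℚS.:= p ℚS.:* p ℚS.:* p ℚS.:* (q ℚS.:* q ℚS.:* q)) refl K E ⟩
    K * K * K * (E * E * E)               ≤⟨ ℚP.*-monoʳ-≤-nonNeg (E * E * E) {{nonNegative 0≤E³}}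
                                               (cube-mono-≤ (ℕtoℚ-nonNeg k) k≤2ηn) ⟩
    ℕtoℚ 2 * η * Nq * (ℕtoℚ 2 * η * Nq) * (ℕtoℚ 2 * η * Nq) * (E * E * E)
                                          ≡⟨ ℚS.solve 3 (λ e m b → ℚS.con (ℕtoℚ 2) ℚS.:* e ℚS.:* m ℚS.:* (ℚS.con (ℕtoℚ 2) ℚS.:* e ℚS.:* m)
                                                ℚS.:* (ℚS.con (ℕtoℚ 2) ℚS.:* e ℚS.:* m) ℚS.:* (b ℚS.:* b ℚS.:* b)
                                                ℚS.:= ℚS.con (ℕtoℚ 8) ℚS.:* e ℚS.:* (m ℚS.:* m ℚS.:* m) ℚS.:* (e ℚS.:* e ℚS.:* (b ℚS.:* b ℚS.:* b)))
                                                refl η Nq E ⟩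
    8ηn³ * (η * η * (E * E * E))          ≤⟨ ℚP.*-monoˡ-≤-nonNeg 8ηn³ {{nonNegative 0≤8ηn³}}
                                               (bad-degree-cube-≤ η d 0<η η≤η₀ ηd²<1) ⟩
    8ηn³ * 1ℚ                             ≡⟨ ℚP.*-identityʳ 8ηn³ ⟩
    8ηn³                                  ≤⟨ 8ηn³≤a³ ⟩
    ℕtoℚ a * ℕtoℚ a * ℕtoℚ a              ≡⟨ ℕtoℚ-cube a ⟩
    ℕtoℚ (a ℕ.* a ℕ.* a)                  ∎

integer-above : ∀ M m → 0ℚ ≤ M → M < ℕtoℚ m →
                Σ ℕ λ k → (M < ℕtoℚ k) × (k ℕ.≤ m) × (ℕtoℚ k ≤ M + 1ℚ)
integer-above M zero 0≤M M<0 = ⊥-elim (<-irrefl refl (≤-<-trans 0≤M M<0))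
integer-above M (suc m) 0≤M M<1+m with M <? ℕtoℚ m
... | yes M<m with integer-above M m 0≤M M<m
...   | k , M<k , k≤m , k≤M+1 = k , M<k , ℕP.m≤n⇒m≤1+n k≤m , k≤M+1
integer-above M (suc m) 0≤M M<1+m | no M≮m =
  suc m , M<1+m , ℕP.≤-refl ,
  subst (_≤ M + 1ℚ) (trans (ℕtoℚ-+ m 1) (cong ℕtoℚ (ℕP.+-comm m 1))) (ℚP.+-monoˡ-≤ 1ℚ (≮⇒≥ M≮m))

above-nonNeg⇒nonZero : ∀ M k → 0ℚ ≤ M → M < ℕtoℚ k → NonZero k
above-nonNeg⇒nonZero M zero 0≤M M<0 = ⊥-elim (<-irrefl refl (≤-<-trans 0≤M M<0))
above-nonNeg⇒nonZero M (suc k) _ _ = _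

subset-of-size : ∀ {n} (p : Subset n) k → k ℕ.≤ ∣ p ∣ → Σ (Subset n) λ q → q ⊆ p × ∣ q ∣ ≡ k
subset-of-size [] zero z≤n = [] , (λ x∈ → x∈) , refl
subset-of-size {n} (true ∷ p) zero _ = ⊥ , (λ x∈⊥ → ⊥-elim (∉⊥ x∈⊥)) , ∣⊥∣≡0 n
subset-of-size (true ∷ p) (suc k) (s≤s k≤∣p∣) with subset-of-size p k k≤∣p∣
... | q , q⊆p , ∣q∣≡k = true ∷ q , q′⊆p′ , cong suc ∣q∣≡k
  where
  q′⊆p′ : true ∷ q ⊆ true ∷ p
  q′⊆p′ here = here
  q′⊆p′ (there x∈q) = there (q⊆p x∈q)
subset-of-size (false ∷ p) k k≤∣p∣ with subset-of-size p k k≤∣p∣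
... | q , q⊆p , ∣q∣≡k = false ∷ q , q′⊆p′ , ∣q∣≡k
  where
  q′⊆p′ : false ∷ q ⊆ false ∷ p
  q′⊆p′ (there x∈q) = there (q⊆p x∈q)

subset-just-above : ∀ {n} M (B : Subset n) → 0ℚ ≤ M → M < ℕtoℚ ∣ B ∣ →
                    Σ (Subset n) λ S → S ⊆ B × (M < ℕtoℚ ∣ S ∣) × (ℕtoℚ ∣ S ∣ ≤ M + 1ℚ)
subset-just-above M B 0≤M M<∣B∣ with integer-above M ∣ B ∣ 0≤M M<∣B∣
... | k , M<k , k≤∣B∣ , k≤M+1 with subset-of-size B k k≤∣B∣
...   | S , S⊆B , refl = S , S⊆B , M<k , k≤M+1

∣p∪q∣≤∣p∣+∣q∣ : ∀ {n} (p q : Subset n) → ∣ p ∪ q ∣ ℕ.≤ ∣ p ∣ ℕ.+ ∣ q ∣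
∣p∪q∣≤∣p∣+∣q∣ [] [] = z≤n
∣p∪q∣≤∣p∣+∣q∣ (true ∷ p) (true ∷ q) = s≤s (ℕP.≤-trans (∣p∪q∣≤∣p∣+∣q∣ p q) (ℕP.+-monoʳ-≤ ∣ p ∣ (ℕP.n≤1+n _)))
∣p∪q∣≤∣p∣+∣q∣ (true ∷ p) (false ∷ q) = s≤s (∣p∪q∣≤∣p∣+∣q∣ p q)
∣p∪q∣≤∣p∣+∣q∣ (false ∷ p) (true ∷ q) = ℕP.≤-trans (s≤s (∣p∪q∣≤∣p∣+∣q∣ p q)) (ℕP.≤-reflexive (≡-sym (ℕP.+-suc _ _)))
∣p∪q∣≤∣p∣+∣q∣ (false ∷ p) (false ∷ q) = ∣p∪q∣≤∣p∣+∣q∣ p q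

∣p∣≤∣p─q∣+∣q∣ : ∀ {n} (p q : Subset n) → ∣ p ∣ ℕ.≤ ∣ p ─ q ∣ ℕ.+ ∣ q ∣
∣p∣≤∣p─q∣+∣q∣ [] [] = z≤n
∣p∣≤∣p─q∣+∣q∣ (true ∷ p) (true ∷ q) = ℕP.≤-trans (s≤s (∣p∣≤∣p─q∣+∣q∣ p q)) (ℕP.≤-reflexive (≡-sym (ℕP.+-suc _ _)))
∣p∣≤∣p─q∣+∣q∣ (true ∷ p) (false ∷ q) = s≤s (∣p∣≤∣p─q∣+∣q∣ p q)
∣p∣≤∣p─q∣+∣q∣ (false ∷ p) (true ∷ q) = ℕP.≤-trans (∣p∣≤∣p─q∣+∣q∣ p q) (ℕP.+-monoʳ-≤ ∣ p ─ q ∣ (ℕP.n≤1+n _))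
∣p∣≤∣p─q∣+∣q∣ (false ∷ p) (false ∷ q) = ∣p∣≤∣p─q∣+∣q∣ p q

x∈p─q⁻ : ∀ {n} {x : Fin n} (p q : Subset n) → x ∈ p ─ q → x ∈ p × x ∉ q
x∈p─q⁻ (true ∷ p) (false ∷ q) here = here , λ ()
x∈p─q⁻ {x = zero} (false ∷ p) (true ∷ q) ()
x∈p─q⁻ {x = zero} (false ∷ p) (false ∷ q) ()
x∈p─q⁻ {x = zero} (true ∷ p) (true ∷ q) ()
x∈p─q⁻ (_ ∷ p) (_ ∷ q) (there x∈p─q) with x∈p─q⁻ p q x∈p─q
... | x∈p , x∉q = there x∈p , λ { (there x∈q) → x∉q x∈q }

⋃[_] : ∀ {n m} → Subset n → (Fin n → Subset m) → Subset m
⋃[ [] ] F = ⊥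
⋃[ true ∷ S ] F = F zero ∪ ⋃[ S ] (F ∘ suc)
⋃[ false ∷ S ] F = ⋃[ S ] (F ∘ suc)

Σ[_] : ∀ {n} → Subset n → (Fin n → ℕ) → ℕ
Σ[ [] ] g = 0
Σ[ true ∷ S ] g = g zero ℕ.+ Σ[ S ] (g ∘ suc)
Σ[ false ∷ S ] g = Σ[ S ] (g ∘ suc)

⊆-⋃ : ∀ {n m} (S : Subset n) (F : Fin n → Subset m) {i} → i ∈ S → F i ⊆ ⋃[ S ] F
⊆-⋃ (true ∷ S) F here = p⊆p∪q (⋃[ S ] (F ∘ suc))
⊆-⋃ (true ∷ S) F (there i∈S) x∈ = q⊆p∪q (F zero) (⋃[ S ] (F ∘ suc)) (⊆-⋃ S (F ∘ suc) i∈S x∈)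
⊆-⋃ (false ∷ S) F (there i∈S) = ⊆-⋃ S (F ∘ suc) i∈S

∣⋃∣≤Σ∣∣ : ∀ {n m} (S : Subset n) (F : Fin n → Subset m) → ∣ ⋃[ S ] F ∣ ℕ.≤ Σ[ S ] (∣_∣ ∘ F)
∣⋃∣≤Σ∣∣ {m = m} [] F = ℕP.≤-reflexive (∣⊥∣≡0 m)
∣⋃∣≤Σ∣∣ (true ∷ S) F = ℕP.≤-trans (∣p∪q∣≤∣p∣+∣q∣ (F zero) _) (ℕP.+-monoʳ-≤ _ (∣⋃∣≤Σ∣∣ S (F ∘ suc)))
∣⋃∣≤Σ∣∣ (false ∷ S) F = ∣⋃∣≤Σ∣∣ S (F ∘ suc)

Σ-≤ : ∀ {n} (S : Subset n) (g : Fin n → ℕ) c a →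
      (∀ i → i ∈ S → c ℕ.* g i ℕ.≤ a) → c ℕ.* Σ[ S ] g ℕ.≤ ∣ S ∣ ℕ.* a
Σ-≤ [] g c a _ = ℕP.≤-reflexive (ℕP.*-zeroʳ c)
Σ-≤ (true ∷ S) g c a cg≤a =
  ℕP.≤-trans (ℕP.≤-reflexive (ℕP.*-distribˡ-+ c (g zero) _))
    (ℕP.+-mono-≤ (cg≤a zero here) (Σ-≤ S (g ∘ suc) c a (λ i i∈S → cg≤a (suc i) (there i∈S))))
Σ-≤ (false ∷ S) g c a cg≤a = Σ-≤ S (g ∘ suc) c a (λ i i∈S → cg≤a (suc i) (there i∈S))

averaging : ∀ {n} (S : Subset n) (g : Fin n → ℕ) a → .{{_ : NonZero ∣ S ∣}} →
            (∀ i → i ∈ S → ∣ S ∣ ℕ.* g i ℕ.≤ a) → Σ[ S ] g ℕ.≤ a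
averaging S g a ∣S∣g≤a = ℕP.*-cancelˡ-≤ ∣ S ∣ (Σ-≤ S g ∣ S ∣ a ∣S∣g≤a)

Σ-+-const : ∀ {n} (S : Subset n) c (g : Fin n → ℕ) → Σ[ S ] (λ i → c ℕ.+ g i) ≡ c ℕ.* ∣ S ∣ ℕ.+ Σ[ S ] g
Σ-+-const [] c g = ≡-sym (trans (ℕP.+-identityʳ (c ℕ.* 0)) (ℕP.*-zeroʳ c))
Σ-+-const (true ∷ S) c g rewrite Σ-+-const S c (g ∘ suc) =
  ℕS.solve 4 (λ c x s t → c ℕS.:+ x ℕS.:+ (c ℕS.:* s ℕS.:+ t) ℕS.:= c ℕS.:* (ℕS.con 1 ℕS.:+ s) ℕS.:+ (x ℕS.:+ t))
    refl c (g zero) ∣ S ∣ (Σ[ S ] (g ∘ suc))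
Σ-+-const (false ∷ S) c g = Σ-+-const S c (g ∘ suc)

balanced-hole⇒AllHoles : ∀ {n} (G : Graph n) (S T : Subset n) r → ∣ S ∣ ≡ r → ∣ T ∣ ≡ r →
  (∀ x → x ∈ S → x ∉ T) → (∀ u v → u ∈ S → v ∈ T → Adj G u v ≡ false) → AllHoles G r
balanced-hole⇒AllHoles G S T r ∣S∣≡r ∣T∣≡r S∩T=∅ no-edge s t s+t≡r
  with subset-of-size S s (subst (s ℕ.≤_) (trans s+t≡r (≡-sym ∣S∣≡r)) (ℕP.m≤m+n s t))
     | subset-of-size T t (subst (t ℕ.≤_) (trans s+t≡r (≡-sym ∣T∣≡r)) (ℕP.m≤n+m t s))
... | S′ , S′⊆S , ∣S′∣≡s | T′ , T′⊆T , ∣T′∣≡t =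
  S′ , T′ , disjoint , ∣S′∣≡s , ∣T′∣≡t , (λ u v u∈S′ v∈T′ → no-edge u v (S′⊆S u∈S′) (T′⊆T v∈T′))
  where
  disjoint : Empty (S′ ∩ T′)
  disjoint (x , x∈S′∩T′) with x∈p∩q⁻ S′ T′ x∈S′∩T′
  ... | x∈S′ , x∈T′ = S∩T=∅ x (S′⊆S x∈S′) (T′⊆T x∈T′)

non-neighbours : ∀ {n} → Graph n → Subset n → Subset n → Subset n
non-neighbours G W' S = W' ─ (S ∪ ⋃[ S ] (λ u → N G u ∩ W'))

non-neighbours-disjoint : ∀ {n} (G : Graph n) (W' S : Subset n) x → x ∈ S → x ∉ non-neighbours G W' S
non-neighbours-disjoint G W' S x x∈S x∈T =
  proj₂ (x∈p─q⁻ W' (S ∪ ⋃[ S ] (λ u → N G u ∩ W')) x∈T) (p⊆p∪q _ x∈S)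

non-neighbours-no-edge : ∀ {n} (G : Graph n) (W' S : Subset n) u v → u ∈ S →
  v ∈ non-neighbours G W' S → Adj G u v ≡ false
non-neighbours-no-edge G W' S u v u∈S v∈T with Adj G u v in uv
... | false = refl
... | true  = ⊥-elim (v∉S∪Y (q⊆p∪q S Y (⊆-⋃ S F u∈S (x∈p∩q⁺ (v∈N[u] , v∈W')))))
  where
  F = λ w → N G w ∩ W'
  Y = ⋃[ S ] F
  v∈W' = proj₁ (x∈p─q⁻ W' (S ∪ Y) v∈T)
  v∉S∪Y = proj₂ (x∈p─q⁻ W' (S ∪ Y) v∈T)
  v∈N[u] : v ∈ N G u
  v∈N[u] = lookup⇒[]= v (N G u) (trans (lookup∘tabulate (Adj G u) v) uv)

non-neighbours-size : ∀ {n} (G : Graph n) (W' S : Subset n) →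
  2 ℕ.* ∣ S ∣ ℕ.+ Σ[ S ] (deg-in G W') ℕ.≤ ∣ W' ∣ → ∣ S ∣ ℕ.≤ ∣ non-neighbours G W' S ∣
non-neighbours-size G W' S budget = ℕP.+-cancelʳ-≤ (s ℕ.+ Σd) s t s+s+Σd≤t+s+Σd
  where
  Y = ⋃[ S ] (λ u → N G u ∩ W')
  s = ∣ S ∣
  Σd = Σ[ S ] (deg-in G W')
  t = ∣ non-neighbours G W' S ∣
  ∣S∪Y∣≤ : ∣ S ∪ Y ∣ ℕ.≤ s ℕ.+ Σd
  ∣S∪Y∣≤ = ℕP.≤-trans (∣p∪q∣≤∣p∣+∣q∣ S Y) (ℕP.+-monoʳ-≤ s (∣⋃∣≤Σ∣∣ S (λ u → N G u ∩ W')))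
  s+s+Σd≤t+s+Σd : s ℕ.+ (s ℕ.+ Σd) ℕ.≤ t ℕ.+ (s ℕ.+ Σd)
  s+s+Σd≤t+s+Σd = begin
    s ℕ.+ (s ℕ.+ Σd)     ≡⟨ ℕS.solve 2 (λ a b → a ℕS.:+ (a ℕS.:+ b) ℕS.:= ℕS.con 2 ℕS.:* a ℕS.:+ b) refl s Σd ⟩
    2 ℕ.* s ℕ.+ Σd       ≤⟨ budget ⟩
    ∣ W' ∣               ≤⟨ ∣p∣≤∣p─q∣+∣q∣ W' (S ∪ Y) ⟩
    t ℕ.+ ∣ S ∪ Y ∣      ≤⟨ ℕP.+-monoʳ-≤ t ∣S∪Y∣≤ ⟩
    t ℕ.+ (s ℕ.+ Σd)     ∎
    where open ℕP.≤-Reasoning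

sparse-set-hole : ∀ {n} (G : Graph n) (W' S : Subset n) →
  2 ℕ.* ∣ S ∣ ℕ.+ Σ[ S ] (deg-in G W') ℕ.≤ ∣ W' ∣ → AllHoles G ∣ S ∣
sparse-set-hole G W' S budget
  with subset-of-size (non-neighbours G W' S) ∣ S ∣ (non-neighbours-size G W' S budget)
... | T , T⊆ , ∣T∣≡∣S∣ =
  balanced-hole⇒AllHoles G S T ∣ S ∣ refl ∣T∣≡∣S∣
    (λ x x∈S x∈T → non-neighbours-disjoint G W' S x x∈S (T⊆ x∈T))
    (λ u v u∈S v∈T → non-neighbours-no-edge G W' S u v u∈S (T⊆ v∈T))

bad-set-hole : ∀ η n (G : Graph n) (W' S : Subset n) → .{{_ : NonZero ∣ S ∣}} →
  0ℚ < η → η ≤ η₀ →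
  ℕtoℚ 8 * η * (ℕtoℚ n * ℕtoℚ n * ℕtoℚ n) ≤ ℕtoℚ ∣ W' ∣ * ℕtoℚ ∣ W' ∣ * ℕtoℚ ∣ W' ∣ →
  ℕtoℚ ∣ S ∣ ≤ ℕtoℚ 2 * η * ℕtoℚ n →
  (∀ u → u ∈ S → η * (ℕtoℚ (deg-in G W' u) * ℕtoℚ (deg-in G W' u)) < 1ℚ) →
  AllHoles G ∣ S ∣
bad-set-hole η n G W' S 0<η η≤η₀ W'-large S-small S-bad =
  sparse-set-hole G W' S
    (subst (ℕ._≤ ∣ W' ∣) (Σ-+-const S 2 (deg-in G W'))
      (averaging S (λ u → 2 ℕ.+ deg-in G W' u) ∣ W' ∣
        (λ u u∈S → degree-budget η n (∣ S ∣) (deg-in G W' u) (∣ W' ∣) 0<η η≤η₀ S-small (S-bad u u∈S) W'-large)))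

-- If more than 2ηn vertices were bad, choose k of them with ηn < k ≤ 2ηn; they
-- would span a (k,k)-hole, contradicting α̃(G) ≤ ηn.
few-bad-vertices : ∀ (η : ℚ) → InUnit η → η ≤ η₀ →
  ∀ (n : ℕ) → .{{_ : NonZero n}} → (+ 1) / n ≤ η →
  ∀ (G : Graph n) → biIndep≤ G (η * ℕtoℚ n) → ∀ (W' : Subset n) →
  ℕtoℚ 8 * η * (ℕtoℚ n * ℕtoℚ n * ℕtoℚ n) ≤ ℕtoℚ ∣ W' ∣ * ℕtoℚ ∣ W' ∣ * ℕtoℚ ∣ W' ∣ →
  ∀ (B : Subset n) → (∀ w → w ∈ B → ¬ (1ℚ ≤ η * (ℕtoℚ (deg-in G W' w) * ℕtoℚ (deg-in G W' w)))) →
  ℕtoℚ ∣ B ∣ ≤ ℕtoℚ 2 * η * ℕtoℚ n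
few-bad-vertices η (0<η , _) η≤η₀ n 1/n≤η G α̃≤ηn W' W'-large B B-bad =
  decidable-stable (ℕtoℚ ∣ B ∣ ≤? 2ηn) B-not-large
  where
  open ℚP.≤-Reasoning
  M = η * ℕtoℚ n
  2ηn = ℕtoℚ 2 * η * ℕtoℚ n
  1≤M : 1ℚ ≤ M
  1≤M = reciprocal-≤⇒1≤ n η 1/n≤η
  0≤M : 0ℚ ≤ M
  0≤M = ≤-trans (toWitness {a? = 0ℚ ≤? 1ℚ} tt) 1≤M
  2ηn≡M+M : 2ηn ≡ M + M
  2ηn≡M+M = ℚS.solve 2 (λ e x → ℚS.con (ℕtoℚ 2) ℚS.:* e ℚS.:* x ℚS.:= e ℚS.:* x ℚS.:+ e ℚS.:* x) refl η (ℕtoℚ n)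
  M≤2ηn : M ≤ 2ηn
  M≤2ηn = begin
    M        ≡⟨ ≡-sym (ℚP.+-identityʳ M) ⟩
    M + 0ℚ   ≤⟨ ℚP.+-monoʳ-≤ M 0≤M ⟩
    M + M    ≡⟨ ≡-sym 2ηn≡M+M ⟩
    2ηn      ∎
  sample-contradiction : Σ (Subset n) (λ S → S ⊆ B × (M < ℕtoℚ ∣ S ∣) × (ℕtoℚ ∣ S ∣ ≤ M + 1ℚ)) → False
  sample-contradiction (S , S⊆B , M<∣S∣ , ∣S∣≤M+1) =
    <-irrefl refl (<-≤-trans M<∣S∣ (α̃≤ηn ∣ S ∣
      (bad-set-hole η n G W' S {{above-nonNeg⇒nonZero M ∣ S ∣ 0≤M M<∣S∣}} 0<η η≤η₀ W'-large S-small
        (λ u u∈S → ≰⇒> (B-bad u (S⊆B u∈S))))))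
    where
    S-small : ℕtoℚ ∣ S ∣ ≤ 2ηn
    S-small = begin
      ℕtoℚ ∣ S ∣   ≤⟨ ∣S∣≤M+1 ⟩
      M + 1ℚ       ≤⟨ ℚP.+-monoʳ-≤ M 1≤M ⟩
      M + M        ≡⟨ ≡-sym 2ηn≡M+M ⟩
      2ηn          ∎
  B-not-large : ¬ ¬ (ℕtoℚ ∣ B ∣ ≤ 2ηn)
  B-not-large B-large = sample-contradiction (subset-just-above M B 0≤M (≤-<-trans M≤2ηn (≰⇒> B-large)))

-- Lemma 2.7 with η₀ = 1/1024 and f = id.
lemma2p7 : Σ ℚ λ η₀ → InUnit η₀ × Σ (ℚ → ℚ) λ f → IsScale f ×
    (∀ (η : ℚ) → InUnit η → η ≤ η₀ →
    ∀ (n : ℕ) → .{{_ : NonZero n}} → (+ 1) / n ≤ f η →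
    ∀ (G : Graph n) → biIndep≤ G (η * ℕtoℚ n) →
    ∀ (W W' : Subset n) →
    (ℕtoℚ 8 * η * (ℕtoℚ n * ℕtoℚ n * ℕtoℚ n) ≤ ℕtoℚ ∣ W ∣ * ℕtoℚ ∣ W ∣ * ℕtoℚ ∣ W ∣) →
    (ℕtoℚ 8 * η * (ℕtoℚ n * ℕtoℚ n * ℕtoℚ n) ≤ ℕtoℚ ∣ W' ∣ * ℕtoℚ ∣ W' ∣ * ℕtoℚ ∣ W' ∣) →
    ∀ (B : Subset n) → B ⊆ W →
    (∀ w → w ∈ B → ¬ (1ℚ ≤ η * (ℕtoℚ (deg-in G W' w) * ℕtoℚ (deg-in G W' w)))) →
    ℕtoℚ ∣ B ∣ ≤ ℕtoℚ 2 * η * ℕtoℚ n)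
lemma2p7 =
  η₀ , η₀-in-unit , (λ x → x) , identity-is-scale ,
  λ η η-in-unit η≤η₀ n 1/n≤η G α̃≤ηn W W' _ W'-large B _ B-bad →
    few-bad-vertices η η-in-unit η≤η₀ n 1/n≤η G α̃≤ηn W' W'-large B B-bad
  where
  η₀-in-unit : InUnit η₀
  η₀-in-unit = toWitness {a? = 0ℚ <? η₀} tt , toWitness {a? = η₀ ≤? 1ℚ} tt
  identity-is-scale : IsScale (λ x → x)
  identity-is-scale = (λ _ x-in-unit → x-in-unit) , (λ _ _ _ _ x≤y → x≤y)
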